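{- Let $F$ be an $(n,m)$-function and $k\in[n]$. The number $|N_{\mathcal{A},k}(F)|$ of nonvanishing $k$-flats is invariant under degree-$(k-1)$ equivalence; in particular, $k$th-order sum-freedom is invariant under degree-$(k-1)$ equivalence.
   Context: An $(n,m)$-function is a map $\mathbb{F}_2^n\to\mathbb{F}_2^m$; $\deg_{\mathrm{alg}}$ denotes its algebraic degree. A $k$-flat is $U+a$ with $U$ a $k$-dimensional linear subspace of $\mathbb{F}_2^n$, $a\in\mathbb{F}_2^n$; $N_{\mathcal{A},k}(F)$ is the set of $k$-flats $A$ with $\sum_{x\in A}F(x)\neq0$; $F$ is $k$th-order sum-free if every $k$-flat is nonvanishing. For $r\in\{0,\dots,n\}$, two $(n,m)$-functions $F,G$ are degree-$r$ equivalent if there exist an affine permutation $L$ of $\mathbb{F}_2^n$, an affine permutation $M$ of $\mathbb{F}_2^m$ and an $(n,m)$-function $R$ with $\deg_{\mathrm{alg}}(R)=r$ such that $G=M\circ F\circ L+R$. -}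

module Defs where

open import Data.Bool using (Bool; true; false; _xor_; not; if_then_else_)
open import Data.Nat using (ℕ; zero; suc; _⊔_)
open import Data.Vec using (Vec; []; _∷_; replicate; zipWith)
open import Data.List using (List; []; _∷_; map; _++_; foldr; filterᵇ; length)
open import Data.List.Membership.Propositional using (_∈_)
open import Data.List.Relation.Unary.Unique.Propositional using (Unique)
open import Data.Product using (Σ; _×_; _,_; ∃)
open import Relation.Binary.PropositionalEquality using (_≡_; _≢_)
open import Relation.Nullary using (¬_)
open import Function.Bundles using (_⇔_)

V : ℕ → Set
V n = Vec Bool n

zeroV : ∀ {n} → V n
zeroV = replicate _ false

infixl 6 _⊕_
_⊕_ : ∀ {n} → V n → V n → V n
_⊕_ = zipWith _xor_

allV : (n : ℕ) → List (V n)
allV zero = [] ∷ []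
allV (suc n) = map (false ∷_) (allV n) ++ map (true ∷_) (allV n)

lincomb : ∀ {k m} → V k → Vec (V m) k → V m
lincomb [] [] = zeroV
lincomb (c ∷ cs) (v ∷ vs) = (if c then v else zeroV) ⊕ lincomb cs vs

Fun : ℕ → ℕ → Set
Fun n m = V n → V m

_≼ᵇ_ : ∀ {n} → V n → V n → Bool
[] ≼ᵇ [] = true
(true ∷ x) ≼ᵇ (false ∷ u) = false
(_ ∷ x) ≼ᵇ (_ ∷ u) = x ≼ᵇ u

wt : ∀ {n} → V n → ℕ
wt [] = zero
wt (true ∷ x) = suc (wt x)
wt (false ∷ x) = wt x

isZeroᵇ : ∀ {m} → V m → Bool
isZeroᵇ [] = true
isZeroᵇ (true ∷ x) = false
isZeroᵇ (false ∷ x) = isZeroᵇ x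

-- ANF coefficient (vector of the m coordinate coefficients) of x^u:
-- a_u = Σ_{x ≼ u} F(x)   (Möbius transform)
anf : ∀ {n m} → Fun n m → V n → V m
anf {n} F u = foldr (λ x acc → if x ≼ᵇ u then F x ⊕ acc else acc) zeroV (allV n)

-- deg_alg F = max { wt u : some coordinate function of F has x^u in its ANF },
-- with the convention that the zero function has degree 0.
algDeg : ∀ {n m} → Fun n m → ℕ
algDeg {n} F = foldr _⊔_ zero (map wt (filterᵇ (λ u → not (isZeroᵇ (anf F u))) (allV n)))

IsAffinePerm : ∀ {n} → (V n → V n) → Set
IsAffinePerm {n} L =
  Σ (Vec (V n) n) λ A → Σ (V n) λ b →
    (∀ x → L x ≡ lincomb x A ⊕ b) ×
    Σ (V n → V n) λ g → (∀ x → g (L x) ≡ x) × (∀ y → L (g y) ≡ y)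

DegEquiv : ∀ {n m} → ℕ → Fun n m → Fun n m → Set
DegEquiv {n} {m} r F G =
  Σ (V n → V n) λ L → Σ (V m → V m) λ M → Σ (Fun n m) λ R →
    IsAffinePerm L × IsAffinePerm M × algDeg R ≡ r ×
    (∀ x → G x ≡ M (F (L x)) ⊕ R x)

-- Subsets of F_2^n, represented concretely by their truth tables
-- (so that propositional equality is equality of sets)

Tab : ℕ → Set
Tab zero = Bool
Tab (suc n) = Tab n × Tab n

_∈ᵗ_ : ∀ {n} → V n → Tab n → Bool
_∈ᵗ_ {zero} [] t = t
_∈ᵗ_ {suc n} (false ∷ x) (t₀ , t₁) = x ∈ᵗ t₀
_∈ᵗ_ {suc n} (true ∷ x) (t₀ , t₁) = x ∈ᵗ t₁

LinIndep : ∀ {k n} → Vec (V n) k → Set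
LinIndep {k} vs = ∀ (c : V k) → lincomb c vs ≡ zeroV → c ≡ zeroV

IsFlat : ∀ {n} → ℕ → Tab n → Set
IsFlat {n} k A =
  Σ (V n) λ a → Σ (Vec (V n) k) λ vs → LinIndep vs ×
    (∀ x → (x ∈ᵗ A ≡ true) ⇔ (Σ (V k) λ c → x ≡ a ⊕ lincomb c vs))

sumOver : ∀ {n m} → Tab n → Fun n m → V m
sumOver {n} A F = foldr (λ x acc → if x ∈ᵗ A then F x ⊕ acc else acc) zeroV (allV n)

NA : ∀ {n m} → ℕ → Fun n m → Tab n → Set
NA k F A = IsFlat k A × sumOver A F ≢ zeroV

SumFree : ∀ {n m} → ℕ → Fun n m → Set
SumFree {n} k F = ∀ (A : Tab n) → IsFlat k A → sumOver A F ≢ zeroV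

HasSize : ∀ {A : Set} → (A → Set) → ℕ → Set
HasSize {A} P c = Σ (List A) λ xs → Unique xs × length xs ≡ c × (∀ a → (a ∈ xs) ⇔ P a)

{-# OPTIONS --safe #-}

-- Summing over a k-flat a + ⟨v₁, …, v_k⟩ amounts to evaluating the k-th order derivative
-- Δ_{v₁} ⋯ Δ_{v_k} at a, and each derivative lowers the algebraic degree, so a function of
-- degree below k sums to zero over every k-flat. Hence if G = M ∘ F ∘ L + R with deg R = k - 1,
-- the sum of G over a k-flat A is the sum of M ∘ F ∘ L over A, which is the image under the
-- linear part of M of the sum of F over the k-flat L(A) (the constant part of M cancels, a flat
-- having an even number of points). As the linear part of M is injective and A ↦ L(A) permutes
-- the k-flats, A is nonvanishing for G exactly when L(A) is nonvanishing for F.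

module Submission where

open import Defs
open import Algebra.Bundles using (AbelianGroup)
open import Algebra.Structures using (IsAbelianGroup)
import Algebra.Properties.AbelianGroup as AbelianGroupProperties
import Algebra.Properties.CommutativeSemigroup as CommutativeSemigroupProperties
open import Data.Bool using (Bool; true; false; _xor_; not; if_then_else_; T; T?)
open import Data.Bool.Properties using (xor-assoc; xor-comm; xor-identityˡ; xor-identityʳ; xor-same; T-≡)
open import Data.Empty using (⊥-elim)
open import Data.List using (List; []; _∷_; map; _++_; foldr; filterᵇ)
open import Data.List.Membership.Propositional using (_∈_)
open import Data.List.Membership.Propositional.Properties
  using (∈-map⁺; ∈-map⁻; ∈-++⁺ˡ; ∈-++⁺ʳ; ∈-filter⁺; ∈-filter⁻)
open import Data.List.Membership.Propositional.Properties.WithK using (unique∧set⇒bag)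
open import Data.List.Properties using (map-cong; map-∘; length-map)
open import Data.List.Relation.Binary.BagAndSetEquality using (∼bag⇒↭)
open import Data.List.Relation.Binary.Permutation.Propositional using (_↭_; ↭⇒↭ₛ)
import Data.List.Relation.Binary.Permutation.Propositional.Properties as Permutation
import Data.List.Relation.Binary.Permutation.Setoid.Properties as PermutationProperties
open import Data.List.Relation.Unary.Any using (here; there)
open import Data.List.Relation.Unary.All using ([])
open import Data.List.Relation.Unary.AllPairs using ([]; _∷_)
open import Data.List.Relation.Unary.Unique.Propositional using (Unique)
import Data.List.Relation.Unary.Unique.Propositional.Properties as Unique
open import Data.Nat using (ℕ; zero; suc; pred; _⊔_; _≤_; _<_; _∸_; z≤n; s≤s)
open import Data.Nat.Properties using (≤-trans; <-irrefl; m≤m⊔n; m≤n⊔m; n≤0⇒n≡0; pred-mono-≤; pred[n]≤n)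
open import Data.Product using (Σ; _×_; _,_; proj₂)
open import Data.Vec using (Vec; []; _∷_)
import Data.Vec as Vec
open import Data.Vec.Properties using (zipWith-assoc; zipWith-comm; zipWith-identityˡ; zipWith-identityʳ)
open import Function using (_∘_; id; _⇔_; mk⇔; Equivalence; _↔_; Inverse; mk↔ₛ′)
open import Function.Construct.Symmetry using (⇔-sym; ↔-sym)
open import Level using (0ℓ)
open import Relation.Binary.PropositionalEquality
open import Relation.Nullary using (¬_)

⊕-self : ∀ {n} (x : V n) → x ⊕ x ≡ zeroV
⊕-self []      = refl
⊕-self (b ∷ x) = cong₂ _∷_ (xor-same b) (⊕-self x)

⊕-isAbelianGroup : ∀ n → IsAbelianGroup _≡_ (_⊕_ {n}) zeroV id
⊕-isAbelianGroup n = record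
  { isGroup = record
    { isMonoid = record
      { isSemigroup = record
        { isMagma = record { isEquivalence = isEquivalence ; ∙-cong = cong₂ _⊕_ }
        ; assoc = zipWith-assoc xor-assoc }
      ; identity = zipWith-identityˡ xor-identityˡ , zipWith-identityʳ xor-identityʳ }
    ; inverse = ⊕-self , ⊕-self
    ; ⁻¹-cong = id }
  ; comm = zipWith-comm xor-comm }

⊕-abelianGroup : ℕ → AbelianGroup 0ℓ 0ℓ
⊕-abelianGroup n = record { isAbelianGroup = ⊕-isAbelianGroup n }

module ⊕ {n : ℕ} where
  open AbelianGroup (⊕-abelianGroup n) public using (assoc; comm; identityˡ; identityʳ)
  open AbelianGroup (⊕-abelianGroup n) using (commutativeSemigroup)
  open AbelianGroupProperties (⊕-abelianGroup n) public
  open CommutativeSemigroupProperties commutativeSemigroup public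

x⊕[x⊕y]≡y : ∀ {n} (x y : V n) → x ⊕ (x ⊕ y) ≡ y
x⊕[x⊕y]≡y x y = begin
  x ⊕ (x ⊕ y)  ≡⟨ ⊕.assoc x x y ⟨
  (x ⊕ x) ⊕ y  ≡⟨ cong (_⊕ y) (⊕-self x) ⟩
  zeroV ⊕ y    ≡⟨ ⊕.identityˡ y ⟩
  y            ∎
  where open ≡-Reasoning

[x⊕y]⊕[y⊕z]≡x⊕z : ∀ {n} (x y z : V n) → (x ⊕ y) ⊕ (y ⊕ z) ≡ x ⊕ z
[x⊕y]⊕[y⊕z]≡x⊕z x y z = trans (⊕.assoc x y (y ⊕ z)) (cong (x ⊕_) (x⊕[x⊕y]≡y y z))

[x⊕y]⊕[z⊕w]≡[x⊕w]⊕[y⊕z] : ∀ {n} (x y z w : V n) → (x ⊕ y) ⊕ (z ⊕ w) ≡ (x ⊕ w) ⊕ (y ⊕ z)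
[x⊕y]⊕[z⊕w]≡[x⊕w]⊕[y⊕z] x y z w = trans (cong ((x ⊕ y) ⊕_) (⊕.comm z w)) (⊕.interchange x y w z)

infixr 7 _·_
_·_ : ∀ {m} → Bool → V m → V m
b · v = if b then v else zeroV

·-distribʳ-xor : ∀ {m} a b (v : V m) → (a xor b) · v ≡ a · v ⊕ b · v
·-distribʳ-xor true  true  v = sym (⊕-self v)
·-distribʳ-xor true  false v = sym (⊕.identityʳ v)
·-distribʳ-xor false b     v = sym (⊕.identityˡ (b · v))

·-distribˡ-⊕ : ∀ {m} b (x y : V m) → b · (x ⊕ y) ≡ b · x ⊕ b · y
·-distribˡ-⊕ true  x y = refl
·-distribˡ-⊕ false x y = sym (⊕-self zeroV)

lincomb-⊕ : ∀ {k m} (c d : V k) (vs : Vec (V m) k) → lincomb (c ⊕ d) vs ≡ lincomb c vs ⊕ lincomb d vs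
lincomb-⊕ []      []      []       = sym (⊕-self zeroV)
lincomb-⊕ (a ∷ c) (b ∷ d) (v ∷ vs) =
  trans (cong₂ _⊕_ (·-distribʳ-xor a b v) (lincomb-⊕ c d vs)) (⊕.interchange _ _ _ _)

-- Sums over lists and over flats

∑ : ∀ {A : Set} {m} → List A → (A → V m) → V m
∑ xs f = foldr _⊕_ zeroV (map f xs)

syntax ∑ xs (λ x → e) = ∑[ x ∈ xs ] e

module _ {A : Set} {m : ℕ} where

  ∑-cong : ∀ (xs : List A) {f g : A → V m} → f ≗ g → ∑ xs f ≡ ∑ xs g
  ∑-cong xs f≗g = cong (foldr _⊕_ zeroV) (map-cong f≗g xs)

  ∑-zero : ∀ (xs : List A) → ∑[ x ∈ xs ] zeroV {m} ≡ zeroV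
  ∑-zero []       = refl
  ∑-zero (x ∷ xs) = trans (⊕.identityˡ _) (∑-zero xs)

  ∑-⊕ : ∀ (xs : List A) (f g : A → V m) → ∑[ x ∈ xs ] (f x ⊕ g x) ≡ ∑ xs f ⊕ ∑ xs g
  ∑-⊕ []       f g = sym (⊕-self zeroV)
  ∑-⊕ (x ∷ xs) f g = trans (cong (f x ⊕ g x ⊕_) (∑-⊕ xs f g)) (⊕.interchange _ _ _ _)

  ∑-++ : ∀ (xs ys : List A) (f : A → V m) → ∑ (xs ++ ys) f ≡ ∑ xs f ⊕ ∑ ys f
  ∑-++ []       ys f = sym (⊕.identityˡ _)
  ∑-++ (x ∷ xs) ys f = trans (cong (f x ⊕_) (∑-++ xs ys f)) (sym (⊕.assoc _ _ _))

  ∑-map : ∀ {B : Set} (g : B → A) (xs : List B) (f : A → V m) → ∑ (map g xs) f ≡ ∑ xs (f ∘ g)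
  ∑-map g xs f = cong (foldr _⊕_ zeroV) (sym (map-∘ xs))

  ∑-↭ : ∀ {xs ys : List A} (f : A → V m) → xs ↭ ys → ∑ xs f ≡ ∑ ys f
  ∑-↭ f xs↭ys = PermutationProperties.foldr-commMonoid (setoid (V m))
    (AbelianGroup.isCommutativeMonoid (⊕-abelianGroup m)) (↭⇒↭ₛ (Permutation.map⁺ f xs↭ys))

  ∑-filterᵇ : ∀ (p : A → Bool) (xs : List A) (f : A → V m) → ∑ (filterᵇ p xs) f ≡ ∑[ x ∈ xs ] (p x · f x)
  ∑-filterᵇ p []       f = refl
  ∑-filterᵇ p (x ∷ xs) f with p x
  ... | true  = cong (f x ⊕_) (∑-filterᵇ p xs f)
  ... | false = trans (∑-filterᵇ p xs f) (sym (⊕.identityˡ _))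

  foldr-if≡∑ : ∀ (p : A → Bool) (f : A → V m) (xs : List A) →
    foldr (λ x acc → if p x then f x ⊕ acc else acc) zeroV xs ≡ ∑[ x ∈ xs ] (p x · f x)
  foldr-if≡∑ p f []       = refl
  foldr-if≡∑ p f (x ∷ xs) with p x
  ... | true  = cong (f x ⊕_) (foldr-if≡∑ p f xs)
  ... | false = trans (foldr-if≡∑ p f xs) (sym (⊕.identityˡ _))

∈-allV : ∀ {n} (x : V n) → x ∈ allV n
∈-allV []                  = here refl
∈-allV {suc n} (false ∷ x) = ∈-++⁺ˡ (∈-map⁺ (false ∷_) (∈-allV x))
∈-allV {suc n} (true ∷ x)  = ∈-++⁺ʳ (map (false ∷_) (allV n)) (∈-map⁺ (true ∷_) (∈-allV x))

allV-unique : ∀ n → Unique (allV n)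
allV-unique zero    = [] ∷ []
allV-unique (suc n) =
  Unique.++⁺ (Unique.map⁺ ∷-injectiveʳ (allV-unique n)) (Unique.map⁺ ∷-injectiveʳ (allV-unique n)) disjoint
  where
  ∷-injectiveʳ : ∀ {b} {x y : V n} → b ∷ x ≡ b ∷ y → x ≡ y
  ∷-injectiveʳ refl = refl
  disjoint : ∀ {v} → ¬ (v ∈ map (false ∷_) (allV n) × v ∈ map (true ∷_) (allV n))
  disjoint (v∈₀ , v∈₁) with ∈-map⁻ (false ∷_) v∈₀ | ∈-map⁻ (true ∷_) v∈₁
  ... | _ , _ , refl | _ , _ , ()

∑-allV-suc : ∀ {n m} (f : V (suc n) → V m) →
  ∑ (allV (suc n)) f ≡ (∑[ x ∈ allV n ] f (false ∷ x)) ⊕ (∑[ x ∈ allV n ] f (true ∷ x))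
∑-allV-suc {n} f = trans (∑-++ (map (false ∷_) (allV n)) _ f)
  (cong₂ _⊕_ (∑-map (false ∷_) (allV n) f) (∑-map (true ∷_) (allV n) f))

∑-const : ∀ {n m} (v : V m) → ∑[ x ∈ allV (suc n) ] v ≡ zeroV
∑-const {n} v = trans (∑-allV-suc {n} (λ _ → v)) (⊕-self _)

IsCoset : ∀ {n k} → Tab n → V n → Vec (V n) k → Set
IsCoset {n} {k} A a vs = ∀ x → (x ∈ᵗ A ≡ true) ⇔ (Σ (V k) λ c → x ≡ a ⊕ lincomb c vs)

flatSum : ∀ {n m k} → Fun n m → V n → Vec (V n) k → V m
flatSum {k = k} F a vs = ∑[ c ∈ allV k ] F (a ⊕ lincomb c vs)

module _ {n k} {A : Tab n} {a : V n} {vs : Vec (V n) k} (independent : LinIndep vs) (coset : IsCoset A a vs) where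

  private
    point : V k → V n
    point c = a ⊕ lincomb c vs

    point-injective : ∀ {c d} → point c ≡ point d → c ≡ d
    point-injective {c} {d} eq = ⊕.inverseˡ-unique c d (independent (c ⊕ d) (begin
      lincomb (c ⊕ d) vs             ≡⟨ lincomb-⊕ c d vs ⟩
      lincomb c vs ⊕ lincomb d vs    ≡⟨ ⊕.x≈y⇒x∙y⁻¹≈ε (⊕.∙-cancelˡ a _ _ eq) ⟩
      zeroV                          ∎))
      where open ≡-Reasoning

    same-elements : ∀ {x} → x ∈ filterᵇ (_∈ᵗ A) (allV n) ⇔ x ∈ map point (allV k)
    same-elements {x} = mk⇔ to from
      where
      to : x ∈ filterᵇ (_∈ᵗ A) (allV n) → x ∈ map point (allV k)
      to x∈ with Equivalence.to (coset x) (Equivalence.to T-≡ (proj₂ (∈-filter⁻ (T? ∘ (_∈ᵗ A)) {xs = allV n} x∈)))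
      ... | c , refl = ∈-map⁺ point (∈-allV c)
      from : x ∈ map point (allV k) → x ∈ filterᵇ (_∈ᵗ A) (allV n)
      from x∈ with ∈-map⁻ point x∈
      ... | c , _ , x≡ =
        ∈-filter⁺ (T? ∘ (_∈ᵗ A)) (∈-allV x) (Equivalence.from T-≡ (Equivalence.from (coset x) (c , x≡)))

  filterᵇ-coset↭ : filterᵇ (_∈ᵗ A) (allV n) ↭ map point (allV k)
  filterᵇ-coset↭ = ∼bag⇒↭ (unique∧set⇒bag
    (Unique.filter⁺ (T? ∘ (_∈ᵗ A)) (allV-unique n)) (Unique.map⁺ point-injective (allV-unique k)) same-elements)

  sumOver-coset : ∀ {m} (F : Fun n m) → sumOver A F ≡ flatSum F a vs
  sumOver-coset F = begin
    sumOver A F                                ≡⟨ foldr-if≡∑ (_∈ᵗ A) F (allV n) ⟩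
    ∑[ x ∈ allV n ] ((x ∈ᵗ A) · F x)           ≡⟨ ∑-filterᵇ (_∈ᵗ A) (allV n) F ⟨
    ∑ (filterᵇ (_∈ᵗ A) (allV n)) F             ≡⟨ ∑-↭ F filterᵇ-coset↭ ⟩
    ∑ (map point (allV k)) F                   ≡⟨ ∑-map point (allV k) F ⟩
    flatSum F a vs                             ∎
    where open ≡-Reasoning

-- Algebraic degree and derivatives

-- Every monomial in the algebraic normal form of F has degree below d (for d = 0: F = 0).
-- Recursion on the first variable: with F₀ x = F (false ∷ x) and F₁ x = F (true ∷ x), the
-- normal form of F is that of F₀ plus x₁ times that of F₀ ⊕ F₁.
DegreeBelow : ∀ {n m} → ℕ → Fun n m → Set
DegreeBelow {zero}  d F = d ≡ 0 → F [] ≡ zeroV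
DegreeBelow {suc n} d F =
  DegreeBelow d (λ x → F (false ∷ x)) × DegreeBelow (pred d) (λ x → F (false ∷ x) ⊕ F (true ∷ x))

Δ : ∀ {n m} → V n → Fun n m → Fun n m
Δ v F x = F x ⊕ F (x ⊕ v)

DegreeBelow-cong : ∀ {n m d} {F G : Fun n m} → F ≗ G → DegreeBelow d F → DegreeBelow d G
DegreeBelow-cong {zero}      F≗G deg d≡0 = trans (sym (F≗G [])) (deg d≡0)
DegreeBelow-cong {suc n} F≗G (deg₀ , deg₁) =
  DegreeBelow-cong (λ x → F≗G (false ∷ x)) deg₀ ,
  DegreeBelow-cong (λ x → cong₂ _⊕_ (F≗G (false ∷ x)) (F≗G (true ∷ x))) deg₁

DegreeBelow-⊕ : ∀ {n m d} {F G : Fun n m} → DegreeBelow d F → DegreeBelow d G → DegreeBelow d (λ x → F x ⊕ G x)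
DegreeBelow-⊕ {zero} degF degG d≡0 = trans (cong₂ _⊕_ (degF d≡0) (degG d≡0)) (⊕-self zeroV)
DegreeBelow-⊕ {suc n} {F = F} {G} (degF₀ , degF₁) (degG₀ , degG₁) =
  DegreeBelow-⊕ degF₀ degG₀ ,
  DegreeBelow-cong (λ x → ⊕.interchange (F (false ∷ x)) (F (true ∷ x)) (G (false ∷ x)) (G (true ∷ x)))
    (DegreeBelow-⊕ degF₁ degG₁)

DegreeBelow-mono : ∀ {n m d e} {F : Fun n m} → d ≤ e → DegreeBelow d F → DegreeBelow e F
DegreeBelow-mono {zero}  d≤e deg refl  = deg (n≤0⇒n≡0 d≤e)
DegreeBelow-mono {suc n} d≤e (deg₀ , deg₁) = DegreeBelow-mono d≤e deg₀ , DegreeBelow-mono (pred-mono-≤ d≤e) deg₁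

DegreeBelow-zero : ∀ {n m} {F : Fun n m} → DegreeBelow 0 F → ∀ x → F x ≡ zeroV
DegreeBelow-zero {zero}  deg                []          = deg refl
DegreeBelow-zero {suc n} (deg₀ , deg₁) (false ∷ x) = DegreeBelow-zero deg₀ x
DegreeBelow-zero {suc n} (deg₀ , deg₁) (true ∷ x)  =
  trans (sym (⊕.inverseˡ-unique _ _ (DegreeBelow-zero deg₁ x))) (DegreeBelow-zero deg₀ x)

DegreeBelow-restrict₁ : ∀ {n m d} {F : Fun (suc n) m} → DegreeBelow d F → DegreeBelow d (λ x → F (true ∷ x))
DegreeBelow-restrict₁ {F = F} (deg₀ , deg₁) =
  DegreeBelow-cong (λ x → x⊕[x⊕y]≡y (F (false ∷ x)) (F (true ∷ x)))
    (DegreeBelow-⊕ deg₀ (DegreeBelow-mono pred[n]≤n deg₁))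

DegreeBelow-shift : ∀ {n m d} {F : Fun n m} → DegreeBelow d F → ∀ v → DegreeBelow d (λ x → F (x ⊕ v))
DegreeBelow-shift {zero}  deg                []          = deg
DegreeBelow-shift {suc n} (deg₀ , deg₁) (false ∷ v) = DegreeBelow-shift deg₀ v , DegreeBelow-shift deg₁ v
DegreeBelow-shift {suc n} {F = F} deg@(_ , deg₁) (true ∷ v) =
  DegreeBelow-shift (DegreeBelow-restrict₁ {F = F} deg) v ,
  DegreeBelow-cong (λ x → ⊕.comm (F (false ∷ (x ⊕ v))) (F (true ∷ (x ⊕ v)))) (DegreeBelow-shift deg₁ v)

DegreeBelow-Δ : ∀ {n m d} {F : Fun n m} → DegreeBelow d F → ∀ v → DegreeBelow (pred d) (Δ v F)
DegreeBelow-Δ {zero} {F = F} deg [] _ = ⊕-self (F [])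
DegreeBelow-Δ {suc n} {F = F} (deg₀ , deg₁) (false ∷ v) =
  DegreeBelow-Δ deg₀ v ,
  DegreeBelow-cong (λ x → ⊕.interchange (F (false ∷ x)) (F (true ∷ x)) (F (false ∷ (x ⊕ v))) (F (true ∷ (x ⊕ v))))
    (DegreeBelow-Δ deg₁ v)
DegreeBelow-Δ {suc n} {F = F} (deg₀ , deg₁) (true ∷ v) =
  DegreeBelow-cong (λ x → [x⊕y]⊕[y⊕z]≡x⊕z (F (false ∷ x)) (F (false ∷ (x ⊕ v))) (F (true ∷ (x ⊕ v))))
    (DegreeBelow-⊕ (DegreeBelow-Δ deg₀ v) (DegreeBelow-shift deg₁ v)) ,
  DegreeBelow-cong
    (λ x → [x⊕y]⊕[z⊕w]≡[x⊕w]⊕[y⊕z] (F (false ∷ x)) (F (true ∷ x)) (F (false ∷ (x ⊕ v))) (F (true ∷ (x ⊕ v))))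
    (DegreeBelow-Δ deg₁ v)

anf≡∑ : ∀ {n m} (F : Fun n m) u → anf F u ≡ ∑[ x ∈ allV n ] ((x ≼ᵇ u) · F x)
anf≡∑ {n} F u = foldr-if≡∑ (_≼ᵇ u) F (allV n)

anf-false : ∀ {n m} (F : Fun (suc n) m) u → anf F (false ∷ u) ≡ anf (λ x → F (false ∷ x)) u
anf-false {n} F u = begin
  anf F (false ∷ u)                                                ≡⟨ anf≡∑ F (false ∷ u) ⟩
  ∑[ x ∈ allV (suc n) ] ((x ≼ᵇ (false ∷ u)) · F x)                  ≡⟨ ∑-allV-suc {n} _ ⟩
  (∑[ x ∈ allV n ] ((x ≼ᵇ u) · F (false ∷ x))) ⊕ (∑[ x ∈ allV n ] zeroV) ≡⟨ cong₂ _⊕_ refl (∑-zero (allV n)) ⟩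
  (∑[ x ∈ allV n ] ((x ≼ᵇ u) · F (false ∷ x))) ⊕ zeroV               ≡⟨ ⊕.identityʳ _ ⟩
  ∑[ x ∈ allV n ] ((x ≼ᵇ u) · F (false ∷ x))                        ≡⟨ anf≡∑ _ u ⟨
  anf (λ x → F (false ∷ x)) u                                      ∎
  where open ≡-Reasoning

anf-true : ∀ {n m} (F : Fun (suc n) m) u → anf F (true ∷ u) ≡ anf (λ x → F (false ∷ x) ⊕ F (true ∷ x)) u
anf-true {n} F u = begin
  anf F (true ∷ u)                                                 ≡⟨ anf≡∑ F (true ∷ u) ⟩
  ∑[ x ∈ allV (suc n) ] ((x ≼ᵇ (true ∷ u)) · F x)                   ≡⟨ ∑-allV-suc {n} _ ⟩
  (∑[ x ∈ allV n ] ((x ≼ᵇ u) · F (false ∷ x))) ⊕ (∑[ x ∈ allV n ] ((x ≼ᵇ u) · F (true ∷ x)))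
    ≡⟨ ∑-⊕ (allV n) _ _ ⟨
  ∑[ x ∈ allV n ] ((x ≼ᵇ u) · F (false ∷ x) ⊕ (x ≼ᵇ u) · F (true ∷ x))
    ≡⟨ ∑-cong (allV n) (λ x → sym (·-distribˡ-⊕ (x ≼ᵇ u) _ _)) ⟩
  ∑[ x ∈ allV n ] ((x ≼ᵇ u) · (F (false ∷ x) ⊕ F (true ∷ x)))       ≡⟨ anf≡∑ _ u ⟨
  anf (λ x → F (false ∷ x) ⊕ F (true ∷ x)) u                       ∎
  where open ≡-Reasoning

anf-vanishing⇒DegreeBelow : ∀ {n m} d (F : Fun n m) → (∀ u → d ≤ wt u → anf F u ≡ zeroV) → DegreeBelow d F
anf-vanishing⇒DegreeBelow {zero}  .0 F vanishing refl = trans (sym (⊕.identityʳ (F []))) (vanishing [] z≤n)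
anf-vanishing⇒DegreeBelow {suc n} d  F vanishing =
  anf-vanishing⇒DegreeBelow d _ (λ u d≤ → trans (sym (anf-false F u)) (vanishing (false ∷ u) d≤)) ,
  anf-vanishing⇒DegreeBelow (pred d) _ (λ u d≤ → trans (sym (anf-true F u)) (vanishing (true ∷ u) (pred≤⇒≤suc d d≤)))
  where
  pred≤⇒≤suc : ∀ d {w} → pred d ≤ w → d ≤ suc w
  pred≤⇒≤suc zero    _ = z≤n
  pred≤⇒≤suc (suc d) p = s≤s p

∈⇒≤foldr-⊔ : ∀ {x} {xs : List ℕ} → x ∈ xs → x ≤ foldr _⊔_ 0 xs
∈⇒≤foldr-⊔ {xs = y ∷ _} (here refl) = m≤m⊔n y _
∈⇒≤foldr-⊔ {xs = y ∷ _} (there x∈)  = ≤-trans (∈⇒≤foldr-⊔ x∈) (m≤n⊔m y _)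

isZeroᵇ⇒≡zeroV : ∀ {m} (x : V m) → isZeroᵇ x ≡ true → x ≡ zeroV
isZeroᵇ⇒≡zeroV []          _  = refl
isZeroᵇ⇒≡zeroV (false ∷ x) eq = cong (false ∷_) (isZeroᵇ⇒≡zeroV x eq)

anf-vanishes-above-algDeg : ∀ {n m} (F : Fun n m) u → algDeg F < wt u → anf F u ≡ zeroV
anf-vanishes-above-algDeg {n} F u deg<wt with isZeroᵇ (anf F u) in eq
... | true  = isZeroᵇ⇒≡zeroV (anf F u) eq
... | false = ⊥-elim (<-irrefl refl (≤-trans deg<wt wt≤deg))
  where
  wt≤deg : wt u ≤ algDeg F
  wt≤deg = ∈⇒≤foldr-⊔ (∈-map⁺ wt (∈-filter⁺ (T? ∘ λ v → not (isZeroᵇ (anf F v))) (∈-allV u)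
    (subst (T ∘ not) (sym eq) _)))

DegreeBelow-algDeg : ∀ {n m} (F : Fun n m) → DegreeBelow (suc (algDeg F)) F
DegreeBelow-algDeg F = anf-vanishing⇒DegreeBelow _ F (anf-vanishes-above-algDeg F)

flatSum-∷ : ∀ {n m k} (F : Fun n m) a v (vs : Vec (V n) k) → flatSum F a (v ∷ vs) ≡ flatSum (Δ v F) a vs
flatSum-∷ {k = k} F a v vs = begin
  flatSum F a (v ∷ vs)
    ≡⟨ ∑-allV-suc {k} _ ⟩
  (∑[ c ∈ allV k ] F (a ⊕ (zeroV ⊕ lincomb c vs))) ⊕ (∑[ c ∈ allV k ] F (a ⊕ (v ⊕ lincomb c vs)))
    ≡⟨ ∑-⊕ (allV k) _ _ ⟨
  ∑[ c ∈ allV k ] (F (a ⊕ (zeroV ⊕ lincomb c vs)) ⊕ F (a ⊕ (v ⊕ lincomb c vs)))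
    ≡⟨ ∑-cong (allV k) (λ c →
         cong₂ _⊕_ (cong (λ x → F (a ⊕ x)) (⊕.identityˡ _)) (cong F (⊕.x∙yz≈xz∙y a v _))) ⟩
  flatSum (Δ v F) a vs
    ∎
  where open ≡-Reasoning

DegreeBelow⇒flatSum≡0 : ∀ {n m k} {F : Fun n m} → DegreeBelow k F → ∀ a (vs : Vec (V n) k) → flatSum F a vs ≡ zeroV
DegreeBelow⇒flatSum≡0         deg a []       = trans (⊕.identityʳ _) (DegreeBelow-zero deg _)
DegreeBelow⇒flatSum≡0 {F = F} deg a (v ∷ vs) =
  trans (flatSum-∷ F a v vs) (DegreeBelow⇒flatSum≡0 (DegreeBelow-Δ deg v) a vs)

-- Affine maps

-- Affine maps over F₂ are exactly the maps preserving three-term sums; unlike the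
-- matrix description in IsAffinePerm, this one is evidently inherited by inverses.
IsAffine : ∀ {n p} → (V n → V p) → Set
IsAffine {n} h = ∀ (x y z : V n) → h (x ⊕ y ⊕ z) ≡ h x ⊕ h y ⊕ h z

lincomb-isAffine : ∀ {n p} (A : Vec (V p) n) (b : V p) → IsAffine (λ x → lincomb x A ⊕ b)
lincomb-isAffine A b x y z = begin
  lincomb (x ⊕ y ⊕ z) A ⊕ b
    ≡⟨ cong (_⊕ b) (trans (lincomb-⊕ (x ⊕ y) z A) (cong (_⊕ Z) (lincomb-⊕ x y A))) ⟩
  (X ⊕ Y ⊕ Z) ⊕ b                         ≡⟨ ⊕.assoc (X ⊕ Y) Z b ⟩
  (X ⊕ Y) ⊕ (Z ⊕ b)                       ≡⟨ cong (_⊕ (Z ⊕ b)) (⊕.identityʳ (X ⊕ Y)) ⟨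
  ((X ⊕ Y) ⊕ zeroV) ⊕ (Z ⊕ b)             ≡⟨ cong (λ t → ((X ⊕ Y) ⊕ t) ⊕ (Z ⊕ b)) (⊕-self b) ⟨
  ((X ⊕ Y) ⊕ (b ⊕ b)) ⊕ (Z ⊕ b)           ≡⟨ cong (_⊕ (Z ⊕ b)) (⊕.interchange X Y b b) ⟩
  (X ⊕ b) ⊕ (Y ⊕ b) ⊕ (Z ⊕ b)             ∎
  where
  open ≡-Reasoning
  X Y Z : V _
  X = lincomb x A
  Y = lincomb y A
  Z = lincomb z A

IsAffinePerm⇒IsAffine : ∀ {n} {h : V n → V n} → IsAffinePerm h → IsAffine h
IsAffinePerm⇒IsAffine (A , b , h≗ , _) x y z =
  trans (h≗ _) (trans (lincomb-isAffine A b x y z) (sym (cong₂ _⊕_ (cong₂ _⊕_ (h≗ x) (h≗ y)) (h≗ z))))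

↔-to∘from : ∀ {A B : Set} (e : A ↔ B) y → Inverse.to e (Inverse.from e y) ≡ y
↔-to∘from = Inverse.strictlyInverseˡ

↔-from∘to : ∀ {A B : Set} (e : A ↔ B) x → Inverse.from e (Inverse.to e x) ≡ x
↔-from∘to = Inverse.strictlyInverseʳ

IsAffinePerm⇒↔ : ∀ {n} {h : V n → V n} → IsAffinePerm h → V n ↔ V n
IsAffinePerm⇒↔ {h = h} (_ , _ , _ , h⁻¹ , h⁻¹∘h , h∘h⁻¹) = mk↔ₛ′ h h⁻¹ h∘h⁻¹ h⁻¹∘h

IsAffine-inverse : ∀ {n} (e : V n ↔ V n) → IsAffine (Inverse.to e) → IsAffine (Inverse.from e)
IsAffine-inverse e affine x y z = begin
  from (x ⊕ y ⊕ z)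
    ≡⟨ cong from (cong₂ _⊕_ (cong₂ _⊕_ (↔-to∘from e x) (↔-to∘from e y)) (↔-to∘from e z)) ⟨
  from (to (from x) ⊕ to (from y) ⊕ to (from z))    ≡⟨ cong from (affine _ _ _) ⟨
  from (to (from x ⊕ from y ⊕ from z))              ≡⟨ ↔-from∘to e _ ⟩
  from x ⊕ from y ⊕ from z                          ∎
  where
  open ≡-Reasoning
  open Inverse e using (to; from)

module Affine {n p} {h : V n → V p} (affine : IsAffine h) where

  linear : V n → V p
  linear x = h x ⊕ h zeroV

  h≡linear⊕h0 : ∀ x → h x ≡ linear x ⊕ h zeroV
  h≡linear⊕h0 x = sym (trans (⊕.assoc _ _ _) (trans (cong (h x ⊕_) (⊕-self _)) (⊕.identityʳ _)))

  h-⊕ : ∀ a x → h (a ⊕ x) ≡ h a ⊕ linear x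
  h-⊕ a x = trans (cong h (sym (⊕.identityʳ (a ⊕ x)))) (trans (affine a x zeroV) (⊕.assoc _ _ _))

  linear-zero : linear zeroV ≡ zeroV
  linear-zero = ⊕-self _

  linear-⊕ : ∀ x y → linear (x ⊕ y) ≡ linear x ⊕ linear y
  linear-⊕ x y = trans (cong (_⊕ h zeroV) (h-⊕ x y)) (⊕.xy∙z≈xz∙y (h x) (linear y) (h zeroV))

  linear-· : ∀ b x → linear (b · x) ≡ b · linear x
  linear-· true  x = refl
  linear-· false x = linear-zero

  linear-lincomb : ∀ {k} (c : V k) vs → linear (lincomb c vs) ≡ lincomb c (Vec.map linear vs)
  linear-lincomb []      []       = linear-zero
  linear-lincomb (b ∷ c) (v ∷ vs) = trans (linear-⊕ _ _) (cong₂ _⊕_ (linear-· b v) (linear-lincomb c vs))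

  linear-∑ : ∀ {A : Set} (xs : List A) f → linear (∑ xs f) ≡ ∑[ x ∈ xs ] linear (f x)
  linear-∑ []       f = linear-zero
  linear-∑ (x ∷ xs) f = trans (linear-⊕ _ _) (cong (linear (f x) ⊕_) (linear-∑ xs f))

  linear-injective : ∀ (h⁻¹ : V p → V n) → (∀ x → h⁻¹ (h x) ≡ x) → ∀ x → linear x ≡ zeroV → x ≡ zeroV
  linear-injective h⁻¹ h⁻¹∘h x linear≡0 =
    trans (sym (h⁻¹∘h x)) (trans (cong h⁻¹ (⊕.inverseˡ-unique _ _ linear≡0)) (h⁻¹∘h zeroV))

  h-coset : ∀ {k} a (c : V k) vs → h (a ⊕ lincomb c vs) ≡ h a ⊕ lincomb c (Vec.map linear vs)
  h-coset a c vs = trans (h-⊕ a _) (cong (h a ⊕_) (linear-lincomb c vs))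

  flatSum-∘ : ∀ {m k} (F : Fun p m) a (vs : Vec (V n) k) → flatSum (F ∘ h) a vs ≡ flatSum F (h a) (Vec.map linear vs)
  flatSum-∘ F a vs = ∑-cong (allV _) (λ c → cong F (h-coset a c vs))

  ∘-flatSum : ∀ {q k} (F : Fun q n) a (vs : Vec (V q) (suc k)) → flatSum (h ∘ F) a vs ≡ linear (flatSum F a vs)
  ∘-flatSum {k = k} F a vs = begin
    flatSum (h ∘ F) a vs                                                     ≡⟨ ∑-cong (allV (suc k)) (h≡linear⊕h0 ∘ F′) ⟩
    ∑[ c ∈ allV (suc k) ] (linear (F′ c) ⊕ h zeroV)                         ≡⟨ ∑-⊕ (allV (suc k)) _ _ ⟩
    (∑[ c ∈ allV (suc k) ] linear (F′ c)) ⊕ (∑[ c ∈ allV (suc k) ] h zeroV) ≡⟨ cong₂ _⊕_ refl (∑-const {k} (h zeroV)) ⟩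
    (∑[ c ∈ allV (suc k) ] linear (F′ c)) ⊕ zeroV                           ≡⟨ ⊕.identityʳ _ ⟩
    ∑[ c ∈ allV (suc k) ] linear (F′ c)                                     ≡⟨ linear-∑ (allV (suc k)) _ ⟨
    linear (flatSum F a vs)                                                  ∎
    where
    open ≡-Reasoning
    F′ : V (suc k) → V n
    F′ c = F (a ⊕ lincomb c vs)

-- Subsets of F₂ⁿ and their images

tab : ∀ {n} → (V n → Bool) → Tab n
tab {zero}  p = p []
tab {suc n} p = tab (λ x → p (false ∷ x)) , tab (λ x → p (true ∷ x))

∈ᵗ-tab : ∀ {n} (p : V n → Bool) x → x ∈ᵗ tab p ≡ p x
∈ᵗ-tab p []          = refl
∈ᵗ-tab p (false ∷ x) = ∈ᵗ-tab _ x
∈ᵗ-tab p (true ∷ x)  = ∈ᵗ-tab _ x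

Tab-ext : ∀ {n} {A B : Tab n} → (∀ x → x ∈ᵗ A ≡ x ∈ᵗ B) → A ≡ B
Tab-ext {zero}  eq = eq []
Tab-ext {suc n} eq = cong₂ _,_ (Tab-ext (eq ∘ (false ∷_))) (Tab-ext (eq ∘ (true ∷_)))

preimage : ∀ {n p} → (V n → V p) → Tab p → Tab n
preimage f A = tab (λ x → f x ∈ᵗ A)

preimage-inverse : ∀ {n p} {f : V n → V p} {g : V p → V n} →
  (∀ x → g (f x) ≡ x) → ∀ A → preimage f (preimage g A) ≡ A
preimage-inverse {f = f} {g} g∘f A =
  Tab-ext (λ x → trans (∈ᵗ-tab (λ y → f y ∈ᵗ preimage g A) x)
                 (trans (∈ᵗ-tab (λ y → g y ∈ᵗ A) (f x)) (cong (_∈ᵗ A) (g∘f x))))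

-- The image of a set under a bijection is its preimage under the inverse.
image-↔ : ∀ {n} → V n ↔ V n → Tab n ↔ Tab n
image-↔ e = mk↔ₛ′ (preimage from) (preimage to)
  (preimage-inverse {f = from} {to} (↔-to∘from e)) (preimage-inverse {f = to} {from} (↔-from∘to e))
  where
  open Inverse e using (to; from)

module _ {n} (e : V n ↔ V n) (affine : IsAffine (Inverse.to e)) where

  open Inverse e using (to; from)
  open Affine affine

  IsCoset-image : ∀ {k} {A : Tab n} {a} {vs : Vec (V n) k} →
    IsCoset A a vs → IsCoset (preimage from A) (to a) (Vec.map linear vs)
  IsCoset-image {A = A} {a} {vs} coset y = mk⇔ ∈⇒coset coset⇒∈
    where
    ∈⇒coset : y ∈ᵗ preimage from A ≡ true → Σ (V _) λ c → y ≡ to a ⊕ lincomb c (Vec.map linear vs)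
    ∈⇒coset y∈ with Equivalence.to (coset (from y)) (trans (sym (∈ᵗ-tab _ y)) y∈)
    ... | c , from-y≡ = c , trans (sym (↔-to∘from e y)) (trans (cong to from-y≡) (h-coset a c vs))
    coset⇒∈ : (Σ (V _) λ c → y ≡ to a ⊕ lincomb c (Vec.map linear vs)) → y ∈ᵗ preimage from A ≡ true
    coset⇒∈ (c , y≡) = trans (∈ᵗ-tab _ y)
      (Equivalence.from (coset (from y)) (c , trans (cong from (trans y≡ (sym (h-coset a c vs)))) (↔-from∘to e _)))

  LinIndep-linear : ∀ {k} {vs : Vec (V n) k} → LinIndep vs → LinIndep (Vec.map linear vs)
  LinIndep-linear {vs = vs} independent c lincomb≡0 =
    independent c (linear-injective from (↔-from∘to e) _ (trans (linear-lincomb c vs) lincomb≡0))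

  IsFlat-image : ∀ {k} {A : Tab n} → IsFlat k A → IsFlat k (preimage from A)
  IsFlat-image (a , vs , independent , coset) = to a , Vec.map linear vs , LinIndep-linear independent , IsCoset-image coset

IsFlat-image-⇔ : ∀ {n k} (e : V n ↔ V n) → IsAffine (Inverse.to e) →
  ∀ A → IsFlat k A ⇔ IsFlat k (Inverse.to (image-↔ e) A)
IsFlat-image-⇔ {k = k} e affine A = mk⇔ (IsFlat-image e affine)
  (subst (IsFlat k) (preimage-inverse {f = Inverse.to e} {Inverse.from e} (↔-from∘to e) A)
    ∘ IsFlat-image (↔-sym e) (IsAffine-inverse e affine))

module _ {A B : Set} (e : A ↔ B) {P : A → Set} {Q : B → Set} where

  open Inverse e using (to; from)

  ⇔-transport-sym : (∀ a → P a ⇔ Q (to a)) → ∀ b → Q b ⇔ P (from b)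
  ⇔-transport-sym P⇔Q b = ⇔-sym (subst (λ b′ → P (from b) ⇔ Q b′) (↔-to∘from e b) (P⇔Q (from b)))

  HasSize-map : (∀ a → P a ⇔ Q (to a)) → ∀ {c} → HasSize P c → HasSize Q c
  HasSize-map P⇔Q (xs , unique , length≡ , ∈⇔P) =
    map to xs , Unique.map⁺ to-injective unique , trans (length-map to xs) length≡ , λ b → mk⇔ (∈⇒Q b) (Q⇒∈ b)
    where
    to-injective : ∀ {x y} → to x ≡ to y → x ≡ y
    to-injective {x} {y} eq = trans (sym (↔-from∘to e x)) (trans (cong from eq) (↔-from∘to e y))
    ∈⇒Q : ∀ b → b ∈ map to xs → Q b
    ∈⇒Q b b∈ with ∈-map⁻ to b∈
    ... | a , a∈ , refl = Equivalence.to (P⇔Q a) (Equivalence.to (∈⇔P a) a∈)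
    Q⇒∈ : ∀ b → Q b → b ∈ map to xs
    Q⇒∈ b q = subst (_∈ map to xs) (↔-to∘from e b)
      (∈-map⁺ to (Equivalence.from (∈⇔P (from b)) (Equivalence.to (⇔-transport-sym P⇔Q b) q)))

  ∀-↔ : (∀ a → P a ⇔ Q (to a)) → (∀ a → P a) ⇔ (∀ b → Q b)
  ∀-↔ P⇔Q = mk⇔ (λ all-P b → Equivalence.from (⇔-transport-sym P⇔Q b) (all-P (from b)))
                (λ all-Q a → Equivalence.from (P⇔Q a) (all-Q (to a)))

HasSize-↔ : ∀ {A B : Set} (e : A ↔ B) {P : A → Set} {Q : B → Set} →
  (∀ a → P a ⇔ Q (Inverse.to e a)) → ∀ c → HasSize P c ⇔ HasSize Q c
HasSize-↔ e P⇔Q c = mk⇔ (HasSize-map e P⇔Q) (HasSize-map (↔-sym e) (⇔-transport-sym e P⇔Q))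

-- Degree-r equivalence and flats of dimension r + 1

module DegreeEquivalence {n m r} {F G : Fun n m} {L : V n → V n} {M : V m → V m} {R : Fun n m}
  (L-perm : IsAffinePerm L) (M-perm : IsAffinePerm M) (deg-R : algDeg R ≡ r) (G≗ : ∀ x → G x ≡ M (F (L x)) ⊕ R x)
  where

  private
    L-affine : IsAffine L
    L-affine = IsAffinePerm⇒IsAffine L-perm

    module L = Affine L-affine
    module M = Affine (IsAffinePerm⇒IsAffine M-perm)

    L↔ : V n ↔ V n
    L↔ = IsAffinePerm⇒↔ L-perm

    M↔ : V m ↔ V m
    M↔ = IsAffinePerm⇒↔ M-perm

  image-L : Tab n ↔ Tab n
  image-L = image-↔ L↔

  flatSum-G : ∀ a (vs : Vec (V n) (suc r)) → flatSum G a vs ≡ M.linear (flatSum F (L a) (Vec.map L.linear vs))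
  flatSum-G a vs = begin
    flatSum G a vs                                    ≡⟨ ∑-cong (allV (suc r)) (λ c → G≗ (a ⊕ lincomb c vs)) ⟩
    flatSum (λ x → M (F (L x)) ⊕ R x) a vs            ≡⟨ ∑-⊕ (allV (suc r)) _ _ ⟩
    flatSum (M ∘ F ∘ L) a vs ⊕ flatSum R a vs         ≡⟨ cong₂ _⊕_ refl (DegreeBelow⇒flatSum≡0 R-degreeBelow a vs) ⟩
    flatSum (M ∘ F ∘ L) a vs ⊕ zeroV                  ≡⟨ ⊕.identityʳ _ ⟩
    flatSum (M ∘ F ∘ L) a vs                          ≡⟨ M.∘-flatSum (F ∘ L) a vs ⟩
    M.linear (flatSum (F ∘ L) a vs)                   ≡⟨ cong M.linear (L.flatSum-∘ F a vs) ⟩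
    M.linear (flatSum F (L a) (Vec.map L.linear vs))  ∎
    where
    open ≡-Reasoning
    R-degreeBelow : DegreeBelow (suc r) R
    R-degreeBelow = subst (λ d → DegreeBelow (suc d) R) deg-R (DegreeBelow-algDeg R)

  sumOver-image : ∀ {A} → IsFlat (suc r) A → sumOver A G ≡ M.linear (sumOver (Inverse.to image-L A) F)
  sumOver-image {A} (a , vs , independent , coset) = begin
    sumOver A G                                       ≡⟨ sumOver-coset independent coset G ⟩
    flatSum G a vs                                    ≡⟨ flatSum-G a vs ⟩
    M.linear (flatSum F (L a) (Vec.map L.linear vs))  ≡⟨ cong M.linear (sumOver-coset independent′ coset′ F) ⟨
    M.linear (sumOver (Inverse.to image-L A) F)       ∎
    where
    open ≡-Reasoning
    independent′ : LinIndep (Vec.map L.linear vs)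
    independent′ = LinIndep-linear L↔ L-affine independent
    coset′ : IsCoset (Inverse.to image-L A) (L a) (Vec.map L.linear vs)
    coset′ = IsCoset-image L↔ L-affine coset

  sumOver-image≡0 : ∀ {A} → IsFlat (suc r) A → sumOver A G ≡ zeroV ⇔ sumOver (Inverse.to image-L A) F ≡ zeroV
  sumOver-image≡0 flat = mk⇔
    (λ G≡0 → M.linear-injective (Inverse.from M↔) (↔-from∘to M↔) _ (trans (sym (sumOver-image flat)) G≡0))
    (λ F≡0 → trans (sumOver-image flat) (trans (cong M.linear F≡0) M.linear-zero))

  IsFlat-image-L : ∀ A → IsFlat (suc r) A ⇔ IsFlat (suc r) (Inverse.to image-L A)
  IsFlat-image-L = IsFlat-image-⇔ L↔ L-affine

  NA-image : ∀ A → NA (suc r) G A ⇔ NA (suc r) F (Inverse.to image-L A)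
  NA-image A = mk⇔
    (λ (flat , G≢0) → Equivalence.to (IsFlat-image-L A) flat , G≢0 ∘ Equivalence.from (sumOver-image≡0 flat))
    (λ (flat′ , F≢0) → let flat = Equivalence.from (IsFlat-image-L A) flat′ in
                       flat , F≢0 ∘ Equivalence.to (sumOver-image≡0 flat))

  nonvanishing-image : ∀ A → (IsFlat (suc r) A → sumOver A G ≢ zeroV) ⇔
                             (IsFlat (suc r) (Inverse.to image-L A) → sumOver (Inverse.to image-L A) F ≢ zeroV)
  nonvanishing-image A = mk⇔
    (λ G≢0 flat′ F≡0 → let flat = Equivalence.from (IsFlat-image-L A) flat′ in
                       G≢0 flat (Equivalence.from (sumOver-image≡0 flat) F≡0))
    (λ F≢0 flat G≡0 → F≢0 (Equivalence.to (IsFlat-image-L A) flat) (Equivalence.to (sumOver-image≡0 flat) G≡0))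

corollary2p6 : (n m k : ℕ) → 1 ≤ k → k ≤ n → (F G : Fun n m) →
    DegEquiv (k ∸ 1) F G →
    (∀ (c : ℕ) → HasSize (NA k F) c ⇔ HasSize (NA k G) c) × (SumFree k F ⇔ SumFree k G)
corollary2p6 n m (suc r) _ _ F G (L , M , R , L-perm , M-perm , deg-R , G≗) =
  (λ c → ⇔-sym (HasSize-↔ image-L NA-image c)) , ⇔-sym (∀-↔ image-L nonvanishing-image)
  where open DegreeEquivalence {F = F} L-perm M-perm deg-R G≗
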